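{- There is an absolute constant $C>0$ such that for every integer $k\ge 1$, every (finite) $k$-labelled branching tree $(T,\operatorname{lab})$ has at most $C\cdot 3^k$ leaves.
   Context: Let $\mathcal{CS}=\{1,\dots,k\}\times\{+,-\}$; for a sign $s$ let $\overline{s}$ be the opposite sign. A rooted labelled tree is a pair $(T,\operatorname{lab})$ where $T$ is a finite rooted tree and $\operatorname{lab}:E(T)\to\mathcal{CS}$. For a node $n$, $T_n$ is the subtree rooted at $n$; if $n$ has children $n_1,\dots,n_t$, let $\mathcal{L}(n)=\{\operatorname{lab}(\{n,n_i\}):1\le i\le t\}$ and $\mathcal{LS}(n)=\{(c,s),(c,\overline{s}):(c,s)\in\mathcal{L}(n)\}$. $(T,\operatorname{lab})$ is a $k$-labelled branching tree if: (i) on every path from the root to a leaf, the edges carrying any given label form a connected subpath; and for every node $n$ with children $n_1,\dots,n_t$: (ii) the labels $\operatorname{lab}(\{n,n_i\})$, $1\le i\le t$, are pairwise distinct; (iii) for every $i$, $T_{n_i}$ contains no edge with label in $\mathcal{LS}(n)\setminus\{\operatorname{lab}(\{n,n_i\})\}$. -}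

module Defs where

open import Data.Nat using (ℕ; zero; suc; _+_; _≤_)
open import Data.Fin using (Fin; toℕ)
open import Data.Bool using (Bool; not)
open import Data.Product using (Σ; _×_; _,_; proj₁; proj₂)
open import Data.Sum using (_⊎_)
open import Data.List using (List; []; _∷_; map; length; lookup)
open import Data.List.Membership.Propositional using (_∈_)
open import Data.List.Relation.Unary.Any using (Any)
open import Data.List.Relation.Unary.Unique.Propositional using (Unique)
open import Relation.Binary.PropositionalEquality using (_≡_; _≢_)
open import Relation.Nullary using (¬_)

-- Labels CS = {1..k} × {+,-}; colours are Fin k, signs are Bool.
Label : ℕ → Set
Label k = Fin k × Bool

opp : ∀ {k} → Label k → Label k
opp (c , s) = c , not s

data LTree (k : ℕ) : Set where
  node : List (Label k × LTree k) → LTree k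

mutual
  leaves : ∀ {k} → LTree k → ℕ
  leaves (node []) = 1
  leaves (node (c ∷ cs)) = leavesF (c ∷ cs)

  leavesF : ∀ {k} → List (Label k × LTree k) → ℕ
  leavesF [] = 0
  leavesF ((_ , t) ∷ cs) = leaves t + leavesF cs

data _≼_ {k : ℕ} : LTree k → LTree k → Set where
  here  : ∀ {t} → t ≼ t
  there : ∀ {s l c cs} → (l , c) ∈ cs → s ≼ c → s ≼ node cs

data RootLeafPath {k : ℕ} : LTree k → List (Label k) → Set where
  leaf : RootLeafPath (node []) []
  step : ∀ {l c cs ls} → (l , c) ∈ cs → RootLeafPath c ls →
         RootLeafPath (node cs) (l ∷ ls)

data HasEdge {k : ℕ} : LTree k → Label k → Set where
  edge   : ∀ {l c cs} → (l , c) ∈ cs → HasEdge (node cs) l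
  deeper : ∀ {l l' c cs} → (l' , c) ∈ cs → HasEdge c l → HasEdge (node cs) l

Connected : ∀ {k} → List (Label k) → Set
Connected {k} ls = (ℓ : Label k) (i j m : Fin (length ls)) →
  toℕ i ≤ toℕ j → toℕ j ≤ toℕ m →
  lookup ls i ≡ ℓ → lookup ls m ≡ ℓ → lookup ls j ≡ ℓ

InLS : ∀ {k} → List (Label k × LTree k) → Label k → Set
InLS cs ℓ = Any (λ p → ℓ ≡ proj₁ p ⊎ ℓ ≡ opp (proj₁ p)) cs

LocalOK : ∀ {k} → LTree k → Set
LocalOK {k} (node cs) =
  Unique (map proj₁ cs) ×
  ((l : Label k) (c : LTree k) → (l , c) ∈ cs →
     (ℓ : Label k) → InLS cs ℓ → ℓ ≢ l → ¬ HasEdge c ℓ)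

Branching : ∀ {k} → LTree k → Set
Branching t =
  (∀ ls → RootLeafPath t ls → Connected ls) ×
  (∀ n → n ≼ t → LocalOK n)

{-# OPTIONS --safe #-}
-- Pass down a budget A of available colours.  At a node n whose incoming edge is labelled ℓ,
-- call the colours of the child labels other than ℓ fresh.  Below a child edge l, condition (iii)
-- forbids every label of a fresh colour except l itself, and connectivity of root-leaf paths forbids ℓ;
-- so the children of n can be given the budget A minus the s fresh colours.  The child labels are
-- distinct and each is ℓ or has a fresh colour, so n has at most 2s + 1 ≤ 3^s children, and
-- induction bounds the number of leaves by 3^|A| ≤ 3^k.
module Submission where

open import Defs
open import Data.Nat using (ℕ; _*_; _^_; _≤_)
open import Data.Product using (Σ; _×_)

open import Data.Nat using (suc; _+_; z≤n; s≤s)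
open import Data.Nat.Properties
open import Data.Bool using (Bool; true; false)
import Data.Bool.Properties as Bool
open import Data.Empty using (⊥-elim)
open import Data.Fin using (Fin) renaming (zero to fzero; suc to fsuc)
import Data.Fin.Properties as Fin
open import Data.Maybe using (Maybe; just; nothing)
import Data.Maybe.Properties as Maybe
open import Data.Product using (∃; _,_; proj₁; proj₂)
import Data.Product.Properties as Product
open import Data.Sum using (_⊎_; inj₁; inj₂)
open import Data.List using (List; []; _∷_; _++_; map; length; filter; fromMaybe; allFin; cartesianProduct)
open import Data.List.Properties using (length-++; length-map; length-tabulate; filter-notAll)
open import Data.List.Membership.Propositional using (_∈_; lose)
open import Data.List.Membership.Propositional.Properties
  using (∈-map⁺; ∈-map⁻; ∈-filter⁺; ∈-filter⁻; ∈-++⁺ˡ; ∈-++⁺ʳ; ∈-allFin; ∈-cartesianProduct⁺)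
import Data.List.Membership.DecPropositional as DecMembership
open import Data.List.Relation.Binary.Subset.Propositional using (_⊆_)
open import Data.List.Relation.Unary.Any as Any using (here; there)
open import Data.List.Relation.Unary.Any.Properties using (lookup-index)
import Data.List.Relation.Unary.All as All
open import Data.List.Relation.Unary.AllPairs using (_∷_)
open import Data.List.Relation.Unary.Unique.Propositional using (Unique)
open import Function using (_∘_; id)
open import Relation.Binary.Definitions using (DecidableEquality)
open import Relation.Binary.PropositionalEquality
open import Relation.Nullary using (yes; no; ¬?)
open import Relation.Unary using (Pred; Decidable)
open import Relation.Unary.Properties using (∁?)

module _ {a} {A : Set a} where

  length-filter-+-∁ : ∀ {p} {P : Pred A p} (P? : Decidable P) xs →
                      length (filter P? xs) + length (filter (∁? P?) xs) ≡ length xs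
  length-filter-+-∁ P? [] = refl
  length-filter-+-∁ P? (x ∷ xs) with P? x
  ... | yes _ = cong suc (length-filter-+-∁ P? xs)
  ... | no _  = trans (+-suc _ _) (cong suc (length-filter-+-∁ P? xs))

  length-cartesianProduct : ∀ {b} {B : Set b} (xs : List A) (ys : List B) →
                            length (cartesianProduct xs ys) ≡ length xs * length ys
  length-cartesianProduct []       ys = refl
  length-cartesianProduct (x ∷ xs) ys = begin
    length (map (x ,_) ys ++ cartesianProduct xs ys)            ≡⟨ length-++ (map (x ,_) ys) ⟩
    length (map (x ,_) ys) + length (cartesianProduct xs ys)    ≡⟨ cong₂ _+_ (length-map (x ,_) ys)
                                                                         (length-cartesianProduct xs ys) ⟩
    length ys + length xs * length ys                           ∎
    where open ≡-Reasoning

  Unique-⊆⇒length≤ : DecidableEquality A → ∀ {xs ys : List A} → Unique xs → xs ⊆ ys → length xs ≤ length ys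
  Unique-⊆⇒length≤ _≟_ {[]}     _               _     = z≤n
  Unique-⊆⇒length≤ _≟_ {x ∷ xs} {ys} (x∉xs ∷ xs!) xs⊆ys = begin-strict
    length xs                  ≤⟨ Unique-⊆⇒length≤ _≟_ xs! (λ y∈xs →
                                    ∈-filter⁺ x≢? (xs⊆ys (there y∈xs)) (All.lookup x∉xs y∈xs)) ⟩
    length (filter x≢? ys)     <⟨ filter-notAll x≢? ys (Any.map (λ x≡y x≢y → x≢y x≡y) (xs⊆ys (here refl))) ⟩
    length ys                  ∎
    where
    open ≤-Reasoning
    x≢? : Decidable (x ≢_)
    x≢? = ¬? ∘ (x ≟_)

suc[2*n]≤3^n : ∀ n → suc (2 * n) ≤ 3 ^ n
suc[2*n]≤3^n 0       = ≤-refl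
suc[2*n]≤3^n (suc n) = begin
  suc (2 * suc n)    ≡⟨ cong suc (*-suc 2 n) ⟩
  3 + 2 * n          ≤⟨ +-monoʳ-≤ 3 (m≤n*m (2 * n) 3) ⟩
  3 + 3 * (2 * n)    ≡⟨ *-distribˡ-+ 3 1 (2 * n) ⟨
  3 * suc (2 * n)    ≤⟨ *-monoʳ-≤ 3 (suc[2*n]≤3^n n) ⟩
  3 * 3 ^ n          ∎
  where open ≤-Reasoning

module _ {k : ℕ} where

  _≟ₗ_ : DecidableEquality (Label k)
  _≟ₗ_ = Product.≡-dec Fin._≟_ Bool._≟_

  sameColour⇒≡⊎≡opp : ∀ {x y : Label k} → proj₁ x ≡ proj₁ y → x ≡ y ⊎ x ≡ opp y
  sameColour⇒≡⊎≡opp {_ , true}  {_ , true}  refl = inj₁ refl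
  sameColour⇒≡⊎≡opp {_ , true}  {_ , false} refl = inj₂ refl
  sameColour⇒≡⊎≡opp {_ , false} {_ , true}  refl = inj₂ refl
  sameColour⇒≡⊎≡opp {_ , false} {_ , false} refl = inj₁ refl

  Connected-∷⁻ : ∀ {x : Label k} {ls} → Connected (x ∷ ls) → Connected ls
  Connected-∷⁻ conn ℓ i j m i≤j j≤m ℓ≡i ℓ≡m = conn ℓ (fsuc i) (fsuc j) (fsuc m) (s≤s i≤j) (s≤s j≤m) ℓ≡i ℓ≡m

  Connected-++⁻ʳ : ∀ (xs : List (Label k)) {ls} → Connected (xs ++ ls) → Connected ls
  Connected-++⁻ʳ []       conn = conn
  Connected-++⁻ʳ (x ∷ xs) conn = Connected-++⁻ʳ xs (Connected-∷⁻ conn)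

  Connected-∷-∷⇒≡ : ∀ {y l : Label k} {ls} → Connected (y ∷ l ∷ ls) → y ∈ ls → l ≡ y
  Connected-∷-∷⇒≡ conn y∈ls =
    conn _ fzero (fsuc fzero) (fsuc (fsuc (Any.index y∈ls))) z≤n (s≤s z≤n) refl (sym (lookup-index y∈ls))

  rootLeafPath : ∀ (t : LTree k) → ∃ (RootLeafPath t)
  rootLeafPath (node [])             = [] , leaf
  rootLeafPath (node ((l , c) ∷ cs)) with ls , p ← rootLeafPath c = l ∷ ls , step (here refl) p

  HasEdge⇒∈-RootLeafPath : ∀ {t : LTree k} {x} → HasEdge t x → ∃ λ ls → RootLeafPath t ls × x ∈ ls
  HasEdge⇒∈-RootLeafPath (edge {c = c} lc∈cs) with ls , p ← rootLeafPath c = _ ∷ ls , step lc∈cs p , here refl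
  HasEdge⇒∈-RootLeafPath (deeper lc∈cs x∈c) with ls , p , x∈ls ← HasEdge⇒∈-RootLeafPath x∈c =
    _ ∷ ls , step lc∈cs p , there x∈ls

-- `inherited` is the label of the edge above the subtree (nothing at the root), and A is the
-- colour budget: every other label occurring in the subtree has a colour in A.
record Constrained {k} (A : List (Fin k)) (inherited : Maybe (Label k)) (t : LTree k) : Set where
  field
    local     : ∀ n → n ≼ t → LocalOK n
    connected : ∀ ls → RootLeafPath t ls → Connected (fromMaybe inherited ++ ls)
    coloured  : ∀ {x} → HasEdge t x → proj₁ x ∈ A ⊎ inherited ≡ just x

module NodeStep {k} {A : List (Fin k)} {inherited : Maybe (Label k)} {cs : List (Label k × LTree k)}
                (t-ok : Constrained A inherited (node cs)) where
  open Constrained t-ok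
  open DecMembership (Fin._≟_ {k}) using (_∈?_)

  fresh? : Decidable (λ l → inherited ≢ just l)
  fresh? l = ¬? (Maybe.≡-dec _≟ₗ_ inherited (just l))

  freshColours : List (Fin k)
  freshColours = map proj₁ (filter fresh? (map proj₁ cs))

  used? : Decidable (_∈ freshColours)
  used? = _∈? freshColours

  spent remaining : List (Fin k)
  spent     = filter used? A
  remaining = filter (∁? used?) A

  spent+remaining≡ : length spent + length remaining ≡ length A
  spent+remaining≡ = length-filter-+-∁ used? A

  fresh⇒InLS : ∀ {x} → proj₁ x ∈ freshColours → InLS cs x
  fresh⇒InLS x∈fresh with l , l∈ , x≡l ← ∈-map⁻ proj₁ x∈fresh
                      with _ , lc∈cs , refl ← ∈-map⁻ proj₁ (proj₁ (∈-filter⁻ fresh? l∈)) =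
    lose lc∈cs (sameColour⇒≡⊎≡opp x≡l)

  child : ∀ {l c} → (l , c) ∈ cs → Constrained remaining (just l) c
  child {l} {c} lc∈cs = record
    { local     = λ n n≼c → local n (there lc∈cs n≼c)
    ; connected = λ ls p → Connected-++⁻ʳ (fromMaybe inherited) (connected (l ∷ ls) (step lc∈cs p))
    ; coloured  = coloured-below
    }
    where
    coloured-below : ∀ {x} → HasEdge c x → proj₁ x ∈ remaining ⊎ just l ≡ just x
    coloured-below {x} x∈c with x ≟ₗ l
    ... | yes refl = inj₂ refl
    ... | no x≢l with proj₁ x ∈? freshColours
    ...   | yes x-fresh = ⊥-elim (proj₂ (local (node cs) here) l c lc∈cs x (fresh⇒InLS x-fresh) x≢l x∈c)
    ...   | no x-unused with coloured (deeper lc∈cs x∈c)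
    ...     | inj₁ x∈A         = inj₁ (∈-filter⁺ (∁? used?) x∈A x-unused)
    ...     | inj₂ inherited≡x with ls , p , x∈ls ← HasEdge⇒∈-RootLeafPath x∈c =
      ⊥-elim (x≢l (sym (Connected-∷-∷⇒≡ conn x∈ls)))
      where
      conn : Connected (x ∷ l ∷ ls)
      conn = subst (λ m → Connected (fromMaybe m ++ l ∷ ls)) inherited≡x (connected (l ∷ ls) (step lc∈cs p))

  signs : List Bool
  signs = true ∷ false ∷ []

  labels⊆ : map proj₁ cs ⊆ fromMaybe inherited ++ cartesianProduct spent signs
  labels⊆ l∈ with (l , c) , lc∈cs , refl ← ∈-map⁻ proj₁ l∈ with Maybe.≡-dec _≟ₗ_ inherited (just l)
  ... | yes refl = here refl
  ... | no l-fresh with coloured (edge lc∈cs)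
  ...   | inj₂ inherited≡l = ⊥-elim (l-fresh inherited≡l)
  ...   | inj₁ l∈A = ∈-++⁺ʳ (fromMaybe inherited)
                       (∈-cartesianProduct⁺ (∈-filter⁺ used? l∈A colour-fresh) (sign∈signs (proj₂ l)))
    where
    colour-fresh : proj₁ l ∈ freshColours
    colour-fresh = ∈-map⁺ proj₁ (∈-filter⁺ fresh? l∈ l-fresh)
    sign∈signs : ∀ s → s ∈ signs
    sign∈signs true  = here refl
    sign∈signs false = there (here refl)

  degree≤ : length cs ≤ suc (2 * length spent)
  degree≤ = begin
    length cs                                                   ≡⟨ length-map proj₁ cs ⟨
    length (map proj₁ cs)                                       ≤⟨ Unique-⊆⇒length≤ _≟ₗ_ (proj₁ (local (node cs) here)) labels⊆ ⟩
    length (fromMaybe inherited ++ cartesianProduct spent signs) ≡⟨ length-++ (fromMaybe inherited) ⟩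
    length (fromMaybe inherited) + length (cartesianProduct spent signs)
                                                                ≤⟨ +-mono-≤ (length-fromMaybe≤1 inherited)
                                                                    (≤-reflexive (length-cartesianProduct spent signs)) ⟩
    suc (length spent * 2)                                      ≡⟨ cong suc (*-comm (length spent) 2) ⟩
    suc (2 * length spent)                                      ∎
    where
    open ≤-Reasoning
    length-fromMaybe≤1 : ∀ (m : Maybe (Label k)) → length (fromMaybe m) ≤ 1
    length-fromMaybe≤1 (just _) = ≤-refl
    length-fromMaybe≤1 nothing  = z≤n

mutual
  leaves≤3^ : ∀ {k} {A : List (Fin k)} {inherited t} → Constrained A inherited t → leaves t ≤ 3 ^ length A
  leaves≤3^ {A = A} {t = node []} _ = m^n>0 3 (length A)
  leaves≤3^ {A = A} {t = node cs@(_ ∷ _)} t-ok = begin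
    leavesF cs                                 ≤⟨ leavesF≤ {A = remaining} child ⟩
    length cs * 3 ^ length remaining           ≤⟨ *-monoˡ-≤ _ (≤-trans degree≤ (suc[2*n]≤3^n (length spent))) ⟩
    3 ^ length spent * 3 ^ length remaining    ≡⟨ ^-distribˡ-+-* 3 (length spent) _ ⟨
    3 ^ (length spent + length remaining)      ≡⟨ cong (3 ^_) spent+remaining≡ ⟩
    3 ^ length A                               ∎
    where
    open NodeStep t-ok
    open ≤-Reasoning

  leavesF≤ : ∀ {k} {A : List (Fin k)} {cs} → (∀ {l c} → (l , c) ∈ cs → Constrained A (just l) c) →
             leavesF cs ≤ length cs * 3 ^ length A
  leavesF≤ {cs = []}    _     = z≤n
  leavesF≤ {cs = _ ∷ _} below = +-mono-≤ (leaves≤3^ (below (here refl))) (leavesF≤ (below ∘ there))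

lemma11 : Σ ℕ (λ C → (k : ℕ) → 1 ≤ k → (t : LTree k) → Branching t → leaves t ≤ C * 3 ^ k)
lemma11 = 1 , λ k _ t (paths , local) → begin
  leaves t                ≤⟨ leaves≤3^ {A = allFin k} {inherited = nothing} (record { local = local ; connected = paths
                                               ; coloured = λ {x} _ → inj₁ (∈-allFin (proj₁ x)) }) ⟩
  3 ^ length (allFin k)   ≡⟨ cong (3 ^_) (length-tabulate {n = k} id) ⟩
  3 ^ k                   ≡⟨ *-identityˡ (3 ^ k) ⟨
  1 * 3 ^ k               ∎
  where open ≤-Reasoning
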